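{- Let $p$ be an odd prime and let $k$ be an integer with $0 \leq k \leq p$. Let $g \in \mathbb{F}_p[x]$ be a polynomial of degree $kp$ with $g \circ (x+1) = (x+1) \circ g$. Then $g = \sum_{I \in R_k} c_I x^I$ for some $c_I \in \mathbb{F}_p$; that is, the coefficient of $x^J$ in $g$ is zero for every $J \in S_k$.
   Context: Define subsets of the nonnegative integers: $T_0 = \{0\}$, $T_p = \{p^2\}$, and for $0 < k < p$, $T_k = \{ ip + j : i, j \geq 0,\ i + j = k\}$. For $0 \leq k \leq p$ set $R_k = \bigcup_{i=0}^{k} T_i$ and $S_k = \{0, 1, 2, \ldots, kp\} \setminus R_k$. The symbol $\circ$ denotes composition of polynomials. -}

module Defs where

open import Data.Nat using (ℕ; zero; suc; _+_; _*_; _<_; _≤_; NonZero)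
open import Data.Nat.DivMod using (_mod_)
open import Data.Fin using (Fin; toℕ)
open import Data.List using (List; []; _∷_; map)
open import Data.Product using (Σ; ∃; _×_)
open import Relation.Binary.PropositionalEquality using (_≡_; _≢_)
open import Relation.Nullary using (¬_)

data T (p : ℕ) : ℕ → ℕ → Set where
  T-zero : T p 0 0
  T-top  : T p p (p * p)
  T-mid  : ∀ {t} (i j : ℕ) → 0 < t → t < p → i + j ≡ t → T p t (i * p + j)

R : (p k J : ℕ) → Set
R p k J = ∃ λ t → t ≤ k × T p t J

S : (p k J : ℕ) → Set
S p k J = J ≤ k * p × ¬ R p k J

-- The field F_p represented as Fin p with arithmetic mod p,
-- and polynomials in F_p[x] as coefficient lists (constant term first).
module Fp (p : ℕ) .{{_ : NonZero p}} where

  F : Set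
  F = Fin p

  0F 1F : F
  0F = 0 mod p
  1F = 1 mod p

  _+F_ _*F_ : F → F → F
  a +F b = (toℕ a + toℕ b) mod p
  a *F b = (toℕ a * toℕ b) mod p

  Poly : Set
  Poly = List F

  coeff : Poly → ℕ → F
  coeff []       _       = 0F
  coeff (a ∷ as) zero    = a
  coeff (a ∷ as) (suc n) = coeff as n

  addP : Poly → Poly → Poly
  addP []       q        = q
  addP (a ∷ as) []       = a ∷ as
  addP (a ∷ as) (b ∷ bs) = (a +F b) ∷ addP as bs

  scaleP : F → Poly → Poly
  scaleP c q = map (c *F_) q

  mulP : Poly → Poly → Poly
  mulP []       q = []
  mulP (a ∷ as) q = addP (scaleP a q) (0F ∷ mulP as q)

  _∘P_ : Poly → Poly → Poly
  []       ∘P h = []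
  (a ∷ as) ∘P h = addP (a ∷ []) (mulP h (as ∘P h))

  x+1 : Poly
  x+1 = 1F ∷ 1F ∷ []

  -- equality of polynomials (coefficientwise; trailing zeros irrelevant)
  _≈P_ : Poly → Poly → Set
  f ≈P g = ∀ n → coeff f n ≡ coeff g n

  HasDegree : Poly → ℕ → Set
  HasDegree f d = coeff f d ≢ 0F × (∀ n → d < n → coeff f n ≡ 0F)

module Submission where

-- Comparing coefficients of x^m in g(x + 1) = g(x) + 1 gives Σᵢ cᵢ C(i, m) ≡ δₘ + cₘ (mod p),
-- where the term i = m cancels cₘ; for m ≥ 1 this leaves (m + 1) c_{m+1} ≡ -Σ_{i > m+1} cᵢ C(i, m).
-- The coefficients indexed by S_k vanish by downward induction: for J = m + 1 ∈ S_k every term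
-- with i > J is 0 mod p, since cᵢ = 0 above the degree and on S_k, p ∣ C(p², m), and for i in a
-- layer T_t with 0 < t ≤ k a comparison of base-p digits gives i mod p < m mod p, so p ∣ C(i, m)
-- by Lucas' theorem. As p ∤ J, this forces c_J = 0.

open import Data.Fin using (toℕ)
open import Data.Fin.Properties using (toℕ-fromℕ<; toℕ<n; toℕ-injective)
open import Data.List using ([]; _∷_; length)
open import Data.Nat
open import Data.Nat.Combinatorics
  using (_C_; nCn≡1; nC1≡n; nCk≡nC[n∸k]; k>n⇒nCk≡0; nCk+nC[k+1]≡[n+1]C[k+1])
open import Data.Nat.DivMod
open import Data.Nat.Divisibility
open import Data.Nat.Primality using (Prime; euclidsLemma; prime⇒nonTrivial)
open import Data.Nat.Properties
open import Data.Nat.Tactic.RingSolver using (solve-∀)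
open import Data.Product using (_×_; _,_)
open import Data.Sum using (inj₁; inj₂; [_,_]′)
open import Function using (id; _∘_; _on_)
open import Level using (0ℓ)
open import Relation.Binary.Bundles using (Setoid)
open import Relation.Binary.Core using (Rel)
open import Relation.Binary.PropositionalEquality
  using (_≡_; _≢_; refl; sym; trans; cong; cong₂; subst; subst₂; setoid; module ≡-Reasoning)
import Relation.Binary.Construct.On as On
import Relation.Binary.Reasoning.Setoid as SetoidReasoning
open import Relation.Nullary using (¬_; Dec; yes; no; contradiction)
open import Relation.Nullary.Decidable using (_×-dec_)

open import Defs

∑< : ℕ → (ℕ → ℕ) → ℕ
∑< zero    t = 0
∑< (suc n) t = ∑< n t + t n

syntax ∑< n (λ i → t) = ∑[ i < n ] t

∑<-cong : ∀ n {t u : ℕ → ℕ} → (∀ i → t i ≡ u i) → ∑< n t ≡ ∑< n u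
∑<-cong zero    _  = refl
∑<-cong (suc n) eq = cong₂ _+_ (∑<-cong n eq) (eq n)

∑<-zero : ∀ n {t : ℕ → ℕ} → (∀ {i} → i < n → t i ≡ 0) → ∑< n t ≡ 0
∑<-zero zero    _ = refl
∑<-zero (suc n) z = cong₂ _+_ (∑<-zero n (z ∘ m<n⇒m<1+n)) (z (n<1+n n))

∑<-distrib-+ : ∀ n (t u : ℕ → ℕ) → ∑[ i < n ] (t i + u i) ≡ ∑< n t + ∑< n u
∑<-distrib-+ zero    t u = refl
∑<-distrib-+ (suc n) t u = trans (cong (_+ (t n + u n)) (∑<-distrib-+ n t u))
                                 (+-interchange (∑< n t) (∑< n u) (t n) (u n))
  where
  +-interchange : ∀ a b c d → (a + b) + (c + d) ≡ (a + c) + (b + d)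
  +-interchange = solve-∀

∑<-suc : ∀ n (t : ℕ → ℕ) → ∑< (suc n) t ≡ t 0 + ∑[ i < n ] t (suc i)
∑<-suc zero    t = +-comm 0 (t 0)
∑<-suc (suc n) t = trans (cong (_+ t (suc n)) (∑<-suc n t)) (+-assoc (t 0) _ _)

∑<-+ : ∀ m n (t : ℕ → ℕ) → ∑< (m + n) t ≡ ∑< m t + ∑[ i < n ] t (m + i)
∑<-+ m zero    t rewrite +-identityʳ m = sym (+-identityʳ _)
∑<-+ m (suc n) t rewrite +-suc m n =
  trans (cong (_+ t (m + n)) (∑<-+ m n t)) (+-assoc (∑< m t) _ _)

∑<-∣ : ∀ {d} n {t : ℕ → ℕ} → (∀ i → d ∣ t i) → d ∣ ∑< n t
∑<-∣ zero    _   = _ ∣0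
∑<-∣ (suc n) d∣t = ∣m∣n⇒∣m+n (∑<-∣ n d∣t) (d∣t n)

[1+n]Cn≡1+n : ∀ n → suc n C n ≡ suc n
[1+n]Cn≡1+n n = begin
  suc n C n             ≡⟨ nCk≡nC[n∸k] (n≤1+n n) ⟩
  suc n C (suc n ∸ n)   ≡⟨ cong (suc n C_) (m+n∸n≡m 1 n) ⟩
  suc n C 1             ≡⟨ nC1≡n (suc n) ⟩
  suc n                 ∎
  where open ≡-Reasoning

[1+k]*[1+n]C[1+k]≡[1+n]*nCk : ∀ n k → suc k * (suc n C suc k) ≡ suc n * (n C k)
[1+k]*[1+n]C[1+k]≡[1+n]*nCk zero    zero    = refl
[1+k]*[1+n]C[1+k]≡[1+n]*nCk zero    (suc k) = *-zeroʳ (suc (suc k))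
[1+k]*[1+n]C[1+k]≡[1+n]*nCk (suc n) zero    =
  trans (*-identityˡ _) (trans (nC1≡n (suc (suc n))) (sym (*-identityʳ _)))
[1+k]*[1+n]C[1+k]≡[1+n]*nCk (suc n) (suc k) = begin
  suc (suc k) * (suc (suc n) C suc (suc k))
    ≡⟨ cong (suc (suc k) *_) (sym (nCk+nC[k+1]≡[n+1]C[k+1] (suc n) (suc k))) ⟩
  suc (suc k) * (A + B)
    ≡⟨ split (suc k) A B ⟩
  suc k * A + A + suc (suc k) * B
    ≡⟨ cong₂ (λ x y → x + A + y) ([1+k]*[1+n]C[1+k]≡[1+n]*nCk n k)
                                 ([1+k]*[1+n]C[1+k]≡[1+n]*nCk n (suc k)) ⟩
  suc n * (n C k) + A + suc n * (n C suc k)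
    ≡⟨ merge (suc n) (n C k) (n C suc k) A ⟩
  suc n * (n C k + n C suc k) + A
    ≡⟨ cong (λ x → suc n * x + A) (nCk+nC[k+1]≡[n+1]C[k+1] n k) ⟩
  suc n * A + A
    ≡⟨ +-comm (suc n * A) A ⟩
  suc (suc n) * A
    ∎
  where
  open ≡-Reasoning
  A = suc n C suc k
  B = suc n C suc (suc k)
  split : ∀ a x y → suc a * (x + y) ≡ a * x + x + suc a * y
  split = solve-∀
  merge : ∀ a x y z → a * x + z + a * y ≡ a * (x + y) + z
  merge = solve-∀

∣∧<⇒≡0 : ∀ {m} n → m ∣ n → n < m → n ≡ 0
∣∧<⇒≡0 zero    _   _   = refl
∣∧<⇒≡0 (suc n) m∣n n<m = contradiction (∣⇒≤ m∣n) (<⇒≱ n<m)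

module Modular (p : ℕ) .{{_ : NonZero p}} where

  infix 4 _≋_
  _≋_ : Rel ℕ 0ℓ
  _≋_ = _≡_ on (_% p)

  ≋-setoid : Setoid 0ℓ 0ℓ
  ≋-setoid = On.setoid (setoid ℕ) (_% p)

  module ≋-Reasoning = SetoidReasoning ≋-setoid

  ≋-+ : ∀ {a a′ b b′} → a ≋ a′ → b ≋ b′ → a + b ≋ a′ + b′
  ≋-+ {a} {a′} {b} {b′} a≋a′ b≋b′ = begin
    (a + b) % p               ≡⟨ %-distribˡ-+ a b p ⟩
    (a % p + b % p) % p       ≡⟨ cong₂ (λ x y → (x + y) % p) a≋a′ b≋b′ ⟩
    (a′ % p + b′ % p) % p     ≡⟨ %-distribˡ-+ a′ b′ p ⟨
    (a′ + b′) % p             ∎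
    where open ≡-Reasoning

  ≋-* : ∀ {a a′ b b′} → a ≋ a′ → b ≋ b′ → a * b ≋ a′ * b′
  ≋-* {a} {a′} {b} {b′} a≋a′ b≋b′ = begin
    (a * b) % p               ≡⟨ %-distribˡ-* a b p ⟩
    (a % p * (b % p)) % p     ≡⟨ cong₂ (λ x y → (x * y) % p) a≋a′ b≋b′ ⟩
    (a′ % p * (b′ % p)) % p   ≡⟨ %-distribˡ-* a′ b′ p ⟨
    (a′ * b′) % p             ∎
    where open ≡-Reasoning

  -- m * p ∸ m serves as an additive inverse of m.
  +-cancelˡ-≋ : ∀ m {n o} → m + n ≋ m + o → n ≋ o
  +-cancelˡ-≋ m {n} {o} eq = begin
    n                         ≈⟨ [m+kn]%n≡m%n n m p ⟨
    n + m * p                 ≡⟨ move n ⟨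
    (m * p ∸ m) + (m + n)     ≈⟨ ≋-+ {m * p ∸ m} refl eq ⟩
    (m * p ∸ m) + (m + o)     ≡⟨ move o ⟩
    o + m * p                 ≈⟨ [m+kn]%n≡m%n o m p ⟩
    o                         ∎
    where
    open ≋-Reasoning
    move : ∀ x → (m * p ∸ m) + (m + x) ≡ x + m * p
    move x = trans (sym (+-assoc (m * p ∸ m) m x))
                   (trans (cong (_+ x) (m∸n+n≡m (m≤m*n m p))) (+-comm (m * p) x))

  m≡m/p*p+m%p : ∀ m → m ≡ m / p * p + m % p
  m≡m/p*p+m%p m = trans (m≡m%n+[m/n]*n m p) (+-comm (m % p) _)

  0%p≡0 : 0 % p ≡ 0
  0%p≡0 = m<n⇒m%n≡m (>-nonZero⁻¹ p)

  ≋0⇒∣ : ∀ {n} → n ≋ 0 → p ∣ n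
  ≋0⇒∣ {n} n≋0 = m%n≡0⇒n∣m n p (trans n≋0 0%p≡0)

  [1+n]%p≡[1+n%p]%p : ∀ n → suc n % p ≡ suc (n % p) % p
  [1+n]%p≡[1+n%p]%p n = trans (cong (λ x → suc x % p) (m≡m%n+[m/n]*n n p))
                              ([m+kn]%n≡m%n (suc (n % p)) (n / p) p)

  [1+n]%p≡1+[n%p] : ∀ n → suc n % p ≢ 0 → suc n % p ≡ suc (n % p)
  [1+n]%p≡1+[n%p] n ≢0 with suc (n % p) <? p
  ... | yes <p = trans ([1+n]%p≡[1+n%p]%p n) (m<n⇒m%n≡m <p)
  ... | no ≮p  = contradiction (trans ([1+n]%p≡[1+n%p]%p n) (trans (cong (_% p) wrap) (n%n≡0 p))) ≢0
    where
    wrap : suc (n % p) ≡ p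
    wrap = ≤-antisym (m%n<n n p) (≮⇒≥ ≮p)

digits-< : ∀ p {a b a′ b′} → b′ < p → a′ + b′ < a + b → b ≤ suc b′ →
           a′ * p + b′ < a * p + b
digits-< p {a} {b} {a′} {b′} b′<p sum< b≤1+b′ with m≤n⇒m<n∨m≡n a′≤a
  where
  a′≤a : a′ ≤ a
  a′≤a = +-cancelʳ-≤ b′ a′ a (s≤s⁻¹ (begin
    suc (a′ + b′)   ≤⟨ sum< ⟩
    a + b           ≤⟨ +-monoʳ-≤ a b≤1+b′ ⟩
    a + suc b′      ≡⟨ +-suc a b′ ⟩
    suc (a + b′)    ∎))
    where open ≤-Reasoning
... | inj₁ a′<a = begin-strict
  a′ * p + b′   <⟨ +-monoʳ-< (a′ * p) b′<p ⟩
  a′ * p + p    ≡⟨ +-comm (a′ * p) p ⟩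
  suc a′ * p    ≤⟨ *-monoˡ-≤ p a′<a ⟩
  a * p         ≤⟨ m≤m+n (a * p) b ⟩
  a * p + b     ∎
  where open ≤-Reasoning
... | inj₂ refl = +-monoʳ-< (a * p) (+-cancelˡ-< a b′ b sum<)

module BinomialModPrime (p : ℕ) .{{_ : NonZero p}} (p-prime : Prime p) where
  open Modular p

  %<%⇒p∣nCk : ∀ n k → n % p < k % p → p ∣ n C k
  %<%⇒p∣nCk zero    zero    lt = contradiction lt (<-irrefl refl)
  %<%⇒p∣nCk zero    (suc k) _  = p ∣0
  %<%⇒p∣nCk (suc n) zero    lt = contradiction (subst (suc n % p <_) 0%p≡0 lt) n≮0
  %<%⇒p∣nCk (suc n) (suc k) lt with suc n % p ≟ 0
  ... | yes [1+n]%p≡0 with euclidsLemma (suc k) (suc n C suc k) p-prime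
                              (subst (p ∣_) (sym ([1+k]*[1+n]C[1+k]≡[1+n]*nCk n k))
                                     (∣m⇒∣m*n (n C k) (m%n≡0⇒n∣m (suc n) p [1+n]%p≡0)))
  ...   | inj₁ p∣1+k = contradiction (subst₂ _<_ [1+n]%p≡0 (n∣m⇒m%n≡0 (suc k) p p∣1+k) lt) n≮0
  ...   | inj₂ p∣C   = p∣C
  %<%⇒p∣nCk (suc n) (suc k) lt | no [1+n]%p≢0 =
    subst (p ∣_) (nCk+nC[k+1]≡[n+1]C[k+1] n k)
          (∣m∣n⇒∣m+n (%<%⇒p∣nCk n k (s<s⁻¹ (subst₂ _<_ [1+n]%p [1+k]%p lt)))
                     (%<%⇒p∣nCk n (suc k) (<-trans n%p<[1+n]%p lt)))
    where
    [1+n]%p : suc n % p ≡ suc (n % p)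
    [1+n]%p = [1+n]%p≡1+[n%p] n [1+n]%p≢0
    [1+k]%p : suc k % p ≡ suc (k % p)
    [1+k]%p = [1+n]%p≡1+[n%p] k (λ [1+k]%p≡0 → n≮0 (subst (suc n % p <_) [1+k]%p≡0 lt))
    n%p<[1+n]%p : n % p < suc n % p
    n%p<[1+n]%p = subst (n % p <_) (sym [1+n]%p) (n<1+n _)

  p∣nCk : ∀ n k → p * p ∣ n → 0 < k → k < p * p → p ∣ n C k
  p∣nCk zero    (suc k) _     _ _ = p ∣0
  p∣nCk (suc n) (suc k) p²∣n _ k<p² with suc k % p ≟ 0
  ... | no  k%p≢0 = %<%⇒p∣nCk (suc n) (suc k) (subst (_< suc k % p) (sym n%p≡0) (n≢0⇒n>0 k%p≢0))
    where
    n%p≡0 : suc n % p ≡ 0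
    n%p≡0 = n∣m⇒m%n≡0 _ p (∣-trans (m∣m*n p) p²∣n)
  ... | yes k%p≡0 =
    [ (λ p∣a → contradiction (a≡0 p∣a) a≢0) , id ]′ (euclidsLemma a B p-prime p∣a*B)
    where
    a = suc k / p
    B = suc n C suc k
    1+k≡a*p : suc k ≡ a * p
    1+k≡a*p = sym (m/n*n≡m (m%n≡0⇒n∣m (suc k) p k%p≡0))
    a≢0 : a ≢ 0
    a≢0 a≡0 = 1+n≢0 (trans 1+k≡a*p (cong (_* p) a≡0))
    a≡0 : p ∣ a → a ≡ 0
    a≡0 p∣a = ∣∧<⇒≡0 a p∣a (m<n*o⇒m/o<n k<p²)
    p*[a*B]≡[1+n]*nCk : p * (a * B) ≡ suc n * (n C k)
    p*[a*B]≡[1+n]*nCk = begin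
      p * (a * B)        ≡⟨ *-comm-assoc p a B ⟩
      (a * p) * B        ≡⟨ cong (_* B) 1+k≡a*p ⟨
      suc k * B          ≡⟨ [1+k]*[1+n]C[1+k]≡[1+n]*nCk n k ⟩
      suc n * (n C k)    ∎
      where
      open ≡-Reasoning
      *-comm-assoc : ∀ x y z → x * (y * z) ≡ (y * x) * z
      *-comm-assoc = solve-∀
    p∣a*B : p ∣ a * B
    p∣a*B = *-cancelˡ-∣ p (subst (p * p ∣_) (sym p*[a*B]≡[1+n]*nCk) (∣m⇒∣m*n (n C k) p²∣n))

δ : ℕ → ℕ
δ zero    = 1
δ (suc _) = 0

module Coefficients (p : ℕ) .{{_ : NonZero p}} where
  open Fp p
  open Modular p

  coeffℕ : Poly → ℕ → ℕ
  coeffℕ f n = toℕ (coeff f n)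

  toℕ-mod : ∀ m → toℕ (m mod p) ≋ m
  toℕ-mod m = trans (cong (_% p) (toℕ-fromℕ< _)) (m%n%n≡m%n m p)

  toℕ-0F : toℕ 0F ≡ 0
  toℕ-0F = trans (toℕ-fromℕ< _) 0%p≡0

  coeffℕ-addP : ∀ f g n → coeffℕ (addP f g) n ≋ coeffℕ f n + coeffℕ g n
  coeffℕ-addP []       _        _       rewrite toℕ-0F = refl
  coeffℕ-addP (a ∷ as) []       n       rewrite toℕ-0F | +-identityʳ (coeffℕ (a ∷ as) n) = refl
  coeffℕ-addP (a ∷ as) (b ∷ bs) zero    = toℕ-mod _
  coeffℕ-addP (a ∷ as) (b ∷ bs) (suc n) = coeffℕ-addP as bs n

  coeffℕ-scaleP : ∀ a f n → coeffℕ (scaleP a f) n ≋ toℕ a * coeffℕ f n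
  coeffℕ-scaleP a []       _       rewrite toℕ-0F | *-zeroʳ (toℕ a) = refl
  coeffℕ-scaleP a (b ∷ bs) zero    = toℕ-mod _
  coeffℕ-scaleP a (b ∷ bs) (suc n) = coeffℕ-scaleP a bs n

  coeffℕ-scaleP-1F : ∀ f n → coeffℕ (scaleP 1F f) n ≋ coeffℕ f n
  coeffℕ-scaleP-1F f n = begin
    coeffℕ (scaleP 1F f) n   ≈⟨ coeffℕ-scaleP 1F f n ⟩
    toℕ 1F * coeffℕ f n      ≈⟨ ≋-* (toℕ-mod 1) refl ⟩
    1 * coeffℕ f n           ≡⟨ *-identityˡ _ ⟩
    coeffℕ f n               ∎
    where open ≋-Reasoning

  coeffℕ-[1F] : ∀ n → coeffℕ (1F ∷ []) n ≋ δ n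
  coeffℕ-[1F] zero    = toℕ-mod 1
  coeffℕ-[1F] (suc n) = cong (_% p) toℕ-0F

  coeffℕ-mulP-[] : ∀ f n → coeffℕ (mulP f []) n ≡ 0
  coeffℕ-mulP-[] []       _       = toℕ-0F
  coeffℕ-mulP-[] (a ∷ as) zero    = toℕ-0F
  coeffℕ-mulP-[] (a ∷ as) (suc n) = coeffℕ-mulP-[] as n

  coeffℕ-mulP-[1F]ˡ : ∀ q n → coeffℕ (mulP (1F ∷ []) q) n ≋ coeffℕ q n
  coeffℕ-mulP-[1F]ˡ q n = begin
    coeffℕ (mulP (1F ∷ []) q) n                  ≈⟨ coeffℕ-addP (scaleP 1F q) (0F ∷ []) n ⟩
    coeffℕ (scaleP 1F q) n + coeffℕ (0F ∷ []) n  ≈⟨ ≋-+ (coeffℕ-scaleP-1F q n) (cong (_% p) (x·0 n)) ⟩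
    coeffℕ q n + 0                               ≡⟨ +-identityʳ _ ⟩
    coeffℕ q n                                   ∎
    where
    open ≋-Reasoning
    x·0 : ∀ n → coeffℕ (0F ∷ []) n ≡ 0
    x·0 zero    = toℕ-0F
    x·0 (suc _) = toℕ-0F

  coeffℕ-mulP-δʳ : ∀ {Q} → (∀ n → coeffℕ Q n ≋ δ n) →
                   ∀ f n → coeffℕ (mulP f Q) n ≋ coeffℕ f n
  coeffℕ-mulP-δʳ     Q≋δ []       n = refl
  coeffℕ-mulP-δʳ {Q} Q≋δ (a ∷ as) n = begin
    coeffℕ (mulP (a ∷ as) Q) n                         ≈⟨ coeffℕ-addP (scaleP a Q) (0F ∷ mulP as Q) n ⟩
    coeffℕ (scaleP a Q) n + coeffℕ (0F ∷ mulP as Q) n  ≈⟨ ≋-+ (coeffℕ-scaleP a Q n) refl ⟩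
    toℕ a * coeffℕ Q n + coeffℕ (0F ∷ mulP as Q) n     ≈⟨ ≋-+ (≋-* {toℕ a} refl (Q≋δ n)) (shifted n) ⟩
    toℕ a * δ n + coeffℕ (0F ∷ as) n                   ≡⟨ head n ⟩
    coeffℕ (a ∷ as) n                                  ∎
    where
    open ≋-Reasoning
    shifted : ∀ n → coeffℕ (0F ∷ mulP as Q) n ≋ coeffℕ (0F ∷ as) n
    shifted zero    = refl
    shifted (suc n) = coeffℕ-mulP-δʳ Q≋δ as n
    head : ∀ n → toℕ a * δ n + coeffℕ (0F ∷ as) n ≡ coeffℕ (a ∷ as) n
    head zero    rewrite toℕ-0F = trans (+-identityʳ _) (*-identityʳ _)
    head (suc n) rewrite *-zeroʳ (toℕ a) = refl

  coeffℕ-mulP-x+1 : ∀ q n → coeffℕ (mulP x+1 q) n ≋ coeffℕ q n + coeffℕ (0F ∷ q) n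
  coeffℕ-mulP-x+1 q n = begin
    coeffℕ (mulP x+1 q) n
      ≈⟨ coeffℕ-addP (scaleP 1F q) _ n ⟩
    coeffℕ (scaleP 1F q) n + coeffℕ (0F ∷ mulP (1F ∷ []) q) n
      ≈⟨ ≋-+ (coeffℕ-scaleP-1F q n) (shifted n) ⟩
    coeffℕ q n + coeffℕ (0F ∷ q) n
      ∎
    where
    open ≋-Reasoning
    shifted : ∀ n → coeffℕ (0F ∷ mulP (1F ∷ []) q) n ≋ coeffℕ (0F ∷ q) n
    shifted zero    = refl
    shifted (suc n) = coeffℕ-mulP-[1F]ˡ q n

  coeffℕ-x+1-∘P : ∀ g n → coeffℕ (x+1 ∘P g) n ≋ δ n + coeffℕ g n
  coeffℕ-x+1-∘P g n = begin
    coeffℕ (x+1 ∘P g) n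
      ≈⟨ coeffℕ-addP (1F ∷ []) (mulP g ((1F ∷ []) ∘P g)) n ⟩
    coeffℕ (1F ∷ []) n + coeffℕ (mulP g ((1F ∷ []) ∘P g)) n
      ≈⟨ ≋-+ (coeffℕ-[1F] n) (coeffℕ-mulP-δʳ one≋δ g n) ⟩
    δ n + coeffℕ g n
      ∎
    where
    open ≋-Reasoning
    one≋δ : ∀ n → coeffℕ ((1F ∷ []) ∘P g) n ≋ δ n
    one≋δ n = begin
      coeffℕ ((1F ∷ []) ∘P g) n
        ≈⟨ coeffℕ-addP (1F ∷ []) (mulP g []) n ⟩
      coeffℕ (1F ∷ []) n + coeffℕ (mulP g []) n
        ≈⟨ ≋-+ (coeffℕ-[1F] n) (cong (_% p) (coeffℕ-mulP-[] g n)) ⟩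
      δ n + 0
        ≡⟨ +-identityʳ (δ n) ⟩
      δ n
        ∎

  coeffℕ-∘P-x+1 : ∀ f N → length f ≤ N → ∀ n →
                  coeffℕ (f ∘P x+1) n ≋ ∑[ i < N ] (coeffℕ f i * (i C n))
  coeffℕ-∘P-x+1 []       N       _           n =
    cong (_% p) (trans toℕ-0F (sym (∑<-zero N (λ {i} _ → cong (_* (i C n)) toℕ-0F))))
  coeffℕ-∘P-x+1 (a ∷ as) (suc N) (s≤s len≤N) n = begin
    coeffℕ ((a ∷ as) ∘P x+1) n
      ≈⟨ coeffℕ-addP (a ∷ []) (mulP x+1 q) n ⟩
    coeffℕ (a ∷ []) n + coeffℕ (mulP x+1 q) n
      ≈⟨ ≋-+ {coeffℕ (a ∷ []) n} refl (coeffℕ-mulP-x+1 q n) ⟩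
    coeffℕ (a ∷ []) n + (coeffℕ q n + coeffℕ (0F ∷ q) n)
      ≈⟨ pascal n ⟩
    ∑[ i < suc N ] (coeffℕ (a ∷ as) i * (i C n))
      ∎
    where
    open ≋-Reasoning
    q = as ∘P x+1
    IH : ∀ n → coeffℕ q n ≋ ∑[ i < N ] (coeffℕ as i * (i C n))
    IH = coeffℕ-∘P-x+1 as N len≤N
    pascal : ∀ n → coeffℕ (a ∷ []) n + (coeffℕ q n + coeffℕ (0F ∷ q) n)
                   ≋ ∑[ i < suc N ] (coeffℕ (a ∷ as) i * (i C n))
    pascal zero = begin
      toℕ a + (coeffℕ q 0 + toℕ 0F)
        ≈⟨ ≋-+ {toℕ a} refl (≋-+ (IH 0) (cong (_% p) toℕ-0F)) ⟩
      toℕ a + (∑[ i < N ] (coeffℕ as i * 1) + 0)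
        ≡⟨ cong₂ _+_ (sym (*-identityʳ (toℕ a))) (+-identityʳ _) ⟩
      toℕ a * 1 + ∑[ i < N ] (coeffℕ as i * 1)
        ≡⟨ ∑<-suc N _ ⟨
      ∑[ i < suc N ] (coeffℕ (a ∷ as) i * (i C 0))
        ∎
    pascal (suc n) = begin
      toℕ 0F + (coeffℕ q (suc n) + coeffℕ q n)
        ≈⟨ ≋-+ (cong (_% p) toℕ-0F) (≋-+ (IH (suc n)) (IH n)) ⟩
      ∑[ i < N ] (coeffℕ as i * (i C suc n)) + ∑[ i < N ] (coeffℕ as i * (i C n))
        ≡⟨ +-comm (∑[ i < N ] (coeffℕ as i * (i C suc n))) _ ⟩
      ∑[ i < N ] (coeffℕ as i * (i C n)) + ∑[ i < N ] (coeffℕ as i * (i C suc n))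
        ≡⟨ ∑<-distrib-+ N _ _ ⟨
      ∑[ i < N ] (coeffℕ as i * (i C n) + coeffℕ as i * (i C suc n))
        ≡⟨ ∑<-cong N (λ i → trans (sym (*-distribˡ-+ (coeffℕ as i) _ _))
                                  (cong (coeffℕ as i *_) (nCk+nC[k+1]≡[n+1]C[k+1] i n))) ⟩
      ∑[ i < N ] (coeffℕ as i * (suc i C suc n))
        ≡⟨ cong (_+ ∑[ i < N ] (coeffℕ as i * (suc i C suc n))) (*-zeroʳ (toℕ a)) ⟨
      toℕ a * 0 + ∑[ i < N ] (coeffℕ as i * (suc i C suc n))
        ≡⟨ ∑<-suc N _ ⟨
      ∑[ i < suc N ] (coeffℕ (a ∷ as) i * (i C suc n))
        ∎

  commutes⇒∑≋δ+coeff : ∀ g → (g ∘P x+1) ≈P (x+1 ∘P g) → ∀ N → length g ≤ N → ∀ n →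
                        ∑[ i < N ] (coeffℕ g i * (i C n)) ≋ δ n + coeffℕ g n
  commutes⇒∑≋δ+coeff g comm N len≤N n = begin
    ∑[ i < N ] (coeffℕ g i * (i C n))   ≈⟨ coeffℕ-∘P-x+1 g N len≤N n ⟨
    coeffℕ (g ∘P x+1) n                 ≡⟨ cong toℕ (comm n) ⟩
    coeffℕ (x+1 ∘P g) n                 ≈⟨ coeffℕ-x+1-∘P g n ⟩
    δ n + coeffℕ g n                    ∎
    where open ≋-Reasoning

module Commuting (p : ℕ) .{{_ : NonZero p}} (p-prime : Prime p) where
  open Fp p
  open Modular p
  open Coefficients p

  commutes⇒coeff≡0 : ∀ g → (g ∘P x+1) ≈P (x+1 ∘P g) → ∀ m → ¬ p ∣ suc (suc m) →
                     (∀ i → suc (suc m) < i → p ∣ coeffℕ g i * (i C suc m)) →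
                     coeffℕ g (suc (suc m)) ≡ 0
  commutes⇒coeff≡0 g comm m p∤J tail-terms =
    [ (λ p∣c → ∣∧<⇒≡0 (c J) p∣c (toℕ<n _)) , (λ p∣J → contradiction p∣J p∤J) ]′
      (euclidsLemma (c J) J p-prime (∣m+n∣m⇒∣n p∣tail+cJ*J p∣tail))
    where
    j = suc m
    J = suc j
    c = coeffℕ g
    t : ℕ → ℕ
    t i = c i * (i C j)
    L = length g
    tail = ∑[ i < L ] t (suc J + i)
    p∣tail : p ∣ tail
    p∣tail = ∑<-∣ L (λ i → tail-terms (suc J + i) (s≤s (m≤m+n J i)))
    ∑≡ : ∑< (suc J + L) t ≡ c j + (tail + c J * J)
    ∑≡ = begin
      ∑< (suc J + L) t              ≡⟨ ∑<-+ (suc J) L t ⟩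
      ∑< j t + t j + t J + tail     ≡⟨ cong (λ x → x + t j + t J + tail) (∑<-zero j below-j) ⟩
      0 + t j + t J + tail          ≡⟨ cong₂ (λ x y → 0 + c j * x + c J * y + tail)
                                             (nCn≡1 j) ([1+n]Cn≡1+n j) ⟩
      0 + c j * 1 + c J * J + tail  ≡⟨ rearrange (c j) (c J * J) tail ⟩
      c j + (tail + c J * J)        ∎
      where
      open ≡-Reasoning
      below-j : ∀ {i} → i < j → t i ≡ 0
      below-j {i} i<j = trans (cong (c i *_) (k>n⇒nCk≡0 i<j)) (*-zeroʳ (c i))
      rearrange : ∀ a b d → 0 + a * 1 + b + d ≡ a + (d + b)
      rearrange = solve-∀
    p∣tail+cJ*J : p ∣ tail + c J * J
    p∣tail+cJ*J = ≋0⇒∣ (+-cancelˡ-≋ (c j) (begin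
      c j + (tail + c J * J)    ≡⟨ ∑≡ ⟨
      ∑< (suc J + L) t          ≈⟨ commutes⇒∑≋δ+coeff g comm (suc J + L) (m≤n+m L (suc J)) j ⟩
      0 + c j                   ≡⟨ +-comm 0 (c j) ⟩
      c j + 0                   ∎))
      where open ≋-Reasoning

-- For 0 < t < p, the elements of T p t are exactly the n with n / p + n % p ≡ t.
LowDigitSum : (p k n : ℕ) .{{_ : NonZero p}} → Set
LowDigitSum p k n = n / p + n % p ≤ k × n / p + n % p < p

Forbidden : (p k n : ℕ) .{{_ : NonZero p}} → Set
Forbidden p k n = n ≤ k * p × n ≢ p * p × ¬ LowDigitSum p k n

module Layers (p : ℕ) .{{_ : NonZero p}} (k : ℕ) where
  open Modular p

  lowDigitSum? : ∀ n → Dec (LowDigitSum p k n)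
  lowDigitSum? n = (n / p + n % p ≤? k) ×-dec (n / p + n % p <? p)

  S⊆Forbidden : ∀ {n} → S p k n → Forbidden p k n
  S⊆Forbidden {n} (n≤kp , n∉R) = n≤kp , n≢p² , ¬low
    where
    n≢p² : n ≢ p * p
    n≢p² refl = n∉R (p , *-cancelʳ-≤ p k p n≤kp , T-top)
    ¬low : ¬ LowDigitSum p k n
    ¬low (≤k , <p) with n / p + n % p ≟ 0
    ... | yes ≡0 = n∉R (0 , z≤n , subst (T p 0) (sym n≡0) T-zero)
      where
      n≡0 : n ≡ 0
      n≡0 = trans (m≡m/p*p+m%p n)
                  (cong₂ (λ a b → a * p + b) (m+n≡0⇒m≡0 (n / p) ≡0) (m+n≡0⇒n≡0 (n / p) ≡0))
    ... | no ≢0 = n∉R (_ , ≤k , subst (T p _) (sym (m≡m/p*p+m%p n)) n∈T)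
      where
      n∈T : T p (n / p + n % p) (n / p * p + n % p)
      n∈T = T-mid (n / p) (n % p) (n≢0⇒n>0 ≢0) <p refl

  ¬low∧low⇒%<% : ∀ {m n} → ¬ LowDigitSum p k (suc m) → suc m % p ≢ 0 →
                 LowDigitSum p k n → suc m < n → n % p < m % p
  ¬low∧low⇒%<% {m} {n} ¬low-1+m 1+m%p≢0 (ds≤k , ds<p) 1+m<n with n % p <? m % p
  ... | yes lt = lt
  ... | no ≮   = contradiction 1+m<n (<-asym n<1+m)
    where
    ds<ds : n / p + n % p < suc m / p + suc m % p
    ds<ds = ≰⇒> (λ ≤ds → ¬low-1+m (≤-trans ≤ds ds≤k , ≤-<-trans ≤ds ds<p))
    %≤1+% : suc m % p ≤ suc (n % p)
    %≤1+% = subst (_≤ suc (n % p)) (sym ([1+n]%p≡1+[n%p] m 1+m%p≢0)) (s≤s (≮⇒≥ ≮))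
    n<1+m : n < suc m
    n<1+m = begin-strict
      n                               ≡⟨ m≡m/p*p+m%p n ⟩
      n / p * p + n % p               <⟨ digits-< p (m%n<n n p) ds<ds %≤1+% ⟩
      suc m / p * p + suc m % p       ≡⟨ m≡m/p*p+m%p (suc m) ⟨
      suc m                           ∎
      where open ≤-Reasoning

  module _ (k≤p : k ≤ p) where

    Forbidden⇒%≢0 : ∀ {n} → Forbidden p k n → n % p ≢ 0
    Forbidden⇒%≢0 {n} (n≤kp , n≢p² , ¬low) n%p≡0 =
      [ (λ a<p → ¬low (subst (_≤ k) (sym ds≡a) a≤k , subst (_< p) (sym ds≡a) a<p))
      , (λ a≡p → n≢p² (trans n≡a*p (cong (_* p) a≡p))) ]′
      (m≤n⇒m<n∨m≡n (≤-trans a≤k k≤p))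
      where
      a = n / p
      ds≡a : n / p + n % p ≡ a
      ds≡a = trans (cong (a +_) n%p≡0) (+-identityʳ a)
      n≡a*p : n ≡ a * p
      n≡a*p = trans (m≡m/p*p+m%p n) (trans (cong (a * p +_) n%p≡0) (+-identityʳ _))
      a≤k : a ≤ k
      a≤k = *-cancelʳ-≤ a k p (subst (_≤ k * p) n≡a*p n≤kp)

module Vanishing (p : ℕ) .{{_ : NonZero p}} (p-prime : Prime p) (k : ℕ) (k≤p : k ≤ p)
                 (g : Fp.Poly p) (above : ∀ n → k * p < n → Fp.coeff p g n ≡ Fp.0F p)
                 (comm : Fp._≈P_ p (Fp._∘P_ p g (Fp.x+1 p)) (Fp._∘P_ p (Fp.x+1 p) g)) where
  open Fp p
  open Modular p
  open Coefficients p
  open BinomialModPrime p p-prime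
  open Commuting p p-prime
  open Layers p k

  c : ℕ → ℕ
  c = coeffℕ g

  x≡0⇒p∣x*y : ∀ {x} y → x ≡ 0 → p ∣ x * y
  x≡0⇒p∣x*y _ refl = p ∣0

  forbidden-step : ∀ n → Forbidden p k n → (∀ i → n < i → Forbidden p k i → c i ≡ 0) →
                   c n ≡ 0
  forbidden-step zero          F                 _  = contradiction 0%p≡0 (Forbidden⇒%≢0 k≤p F)
  forbidden-step (suc zero)    (1≤kp , _ , ¬low) _  =
    contradiction (subst (_≤ k) (sym ds≡1) 1≤k , subst (_< p) (sym ds≡1) 1<p) ¬low
    where
    1<p : 1 < p
    1<p = nonTrivial⇒n>1 p {{prime⇒nonTrivial p-prime}}
    ds≡1 : 1 / p + 1 % p ≡ 1
    ds≡1 = cong₂ _+_ (m<n⇒m/n≡0 1<p) (m<n⇒m%n≡m 1<p)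
    1≤k : 1 ≤ k
    1≤k = n≢0⇒n>0 (λ k≡0 → contradiction (subst (λ x → 1 ≤ x * p) k≡0 1≤kp) λ ())
  forbidden-step (suc (suc m)) F@(n≤kp , _ , ¬low) IH =
    commutes⇒coeff≡0 g comm m p∤n tail-terms
    where
    n%p≢0 : suc (suc m) % p ≢ 0
    n%p≢0 = Forbidden⇒%≢0 k≤p F
    p∤n : ¬ p ∣ suc (suc m)
    p∤n p∣n = n%p≢0 (n∣m⇒m%n≡0 _ p p∣n)
    tail-terms : ∀ i → suc (suc m) < i → p ∣ c i * (i C suc m)
    tail-terms i n<i with k * p <? i
    ... | yes kp<i = x≡0⇒p∣x*y (i C suc m) (trans (cong toℕ (above i kp<i)) toℕ-0F)
    ... | no  i≤kp with i ≟ p * p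
    ...   | yes refl = ∣n⇒∣m*n (c i) (p∣nCk (p * p) (suc m) ∣-refl z<s
                                         (<-≤-trans (n<1+n _) (≤-trans n≤kp (*-monoˡ-≤ p k≤p))))
    ...   | no  i≢p² with lowDigitSum? i
    ...     | yes low = ∣n⇒∣m*n (c i) (%<%⇒p∣nCk i (suc m) (¬low∧low⇒%<% ¬low n%p≢0 low n<i))
    ...     | no ¬low-i = x≡0⇒p∣x*y (i C suc m) (IH i n<i (≮⇒≥ i≤kp , i≢p² , ¬low-i))

  forbidden-above⇒c≡0 : ∀ d n → k * p ≤ d + n → Forbidden p k n → c n ≡ 0
  forbidden-above⇒c≡0 zero    n kp≤n     F = forbidden-step n F
    λ i n<i (i≤kp , _) → contradiction (≤-<-trans kp≤n n<i) (≤⇒≯ i≤kp)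
  forbidden-above⇒c≡0 (suc d) n kp≤1+d+n F = forbidden-step n F
    λ i n<i → forbidden-above⇒c≡0 d i (begin
      k * p        ≤⟨ kp≤1+d+n ⟩
      suc (d + n)  ≡⟨ +-suc d n ⟨
      d + suc n    ≤⟨ +-monoʳ-≤ d n<i ⟩
      d + i        ∎)
    where open ≤-Reasoning

  forbidden⇒coeff≡0F : ∀ {n} → Forbidden p k n → coeff g n ≡ 0F
  forbidden⇒coeff≡0F {n} F =
    toℕ-injective (trans (forbidden-above⇒c≡0 (k * p) n (m≤m+n (k * p) n) F) (sym toℕ-0F))

lemma6p6 : (p : ℕ) .{{_ : NonZero p}} → Prime p → p % 2 ≡ 1 →
    (k : ℕ) → k ≤ p → (g : Fp.Poly p) → Fp.HasDegree p g (k * p) →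
    Fp._≈P_ p (Fp._∘P_ p g (Fp.x+1 p)) (Fp._∘P_ p (Fp.x+1 p) g) →
    ∀ J → S p k J → Fp.coeff p g J ≡ Fp.0F p
lemma6p6 p p-prime _ k k≤p g (_ , above) comm J J∈S =
  Vanishing.forbidden⇒coeff≡0F p p-prime k k≤p g above comm (Layers.S⊆Forbidden p k J∈S)
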